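{- If $T$ is a tree on at least three vertices, then $\operatorname{dal}(T)\le 2$.
   Context: For an edge-coloring $c:E(G)\to\{1,\dots,k\}$ (not necessarily proper), $\bar c(v)=(a_1,\dots,a_k)$ where $a_i$ is the number of edges at $v$ of color $i$, and $c^*(v)$ is the nonincreasing rearrangement of $\bar c(v)$; $c$ is color-blind distinguishing if $c^*(u)\ne c^*(v)$ for every edge $uv$. $\operatorname{dal}(G)$ is the least $k$ for which such a coloring with colors $\{1,\dots,k\}$ exists ($\infty$ if none). -}

module Defs where

open import Data.Nat using (ℕ; zero; suc; _+_; _≤ᵇ_; _≤_)
open import Data.Bool using (Bool; true; false; if_then_else_)
open import Data.Fin using (Fin)
open import Data.Fin.Properties using (_≟_)
open import Data.List using (List; []; _∷_; _∷ʳ_; length; map; allFin)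
open import Data.Nat.ListAction using (sum)
open import Data.List.Relation.Unary.Linked using (Linked)
open import Data.List.Relation.Unary.Unique.Propositional using (Unique)
open import Data.Product using (Σ; _×_; ∃-syntax)
open import Relation.Binary.PropositionalEquality using (_≡_; _≢_)
open import Relation.Binary.Construct.Closure.ReflexiveTransitive using (Star)
open import Relation.Nullary using (¬_; does)

record Graph (n : ℕ) : Set where
  field
    adj     : Fin n → Fin n → Bool
    sym     : ∀ u v → adj u v ≡ adj v u
    irrefl  : ∀ v → adj v v ≡ false
open Graph public

Adj : ∀ {n} → Graph n → Fin n → Fin n → Set
Adj G u v = adj G u v ≡ true

Connected : ∀ {n} → Graph n → Set
Connected {n} G = ∀ (u v : Fin n) → Star (Adj G) u v

IsCycle : ∀ {n} → Graph n → Fin n → List (Fin n) → Set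
IsCycle G v ws = (2 ≤ length ws) × Unique (v ∷ ws) × Linked (Adj G) ((v ∷ ws) ∷ʳ v)

Acyclic : ∀ {n} → Graph n → Set
Acyclic {n} G = ∀ (v : Fin n) (ws : List (Fin n)) → ¬ IsCycle G v ws

IsTree : ∀ {n} → Graph n → Set
IsTree G = Connected G × Acyclic G

-- an edge colouring with colours Fin k (standing for 1,…,k), not necessarily
-- proper; c u v is the colour of the edge uv (only meaningful on edges)
record EdgeColouring {n} (G : Graph n) (k : ℕ) : Set where
  field
    col     : Fin n → Fin n → Fin k
    col-sym : ∀ u v → Adj G u v → col u v ≡ col v u
open EdgeColouring public

colourCount : ∀ {n k} {G : Graph n} → EdgeColouring G k → Fin n → Fin k → ℕ
colourCount {n} {G = G} c v i =
  sum (map (λ u → if adj G v u then (if does (col c v u ≟ i) then 1 else 0) else 0) (allFin n))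

cbar : ∀ {n k} {G : Graph n} → EdgeColouring G k → Fin n → List ℕ
cbar {k = k} c v = map (colourCount c v) (allFin k)

insertDesc : ℕ → List ℕ → List ℕ
insertDesc x [] = x ∷ []
insertDesc x (y ∷ ys) = if y ≤ᵇ x then x ∷ y ∷ ys else y ∷ insertDesc x ys

sortDesc : List ℕ → List ℕ
sortDesc [] = []
sortDesc (x ∷ xs) = insertDesc x (sortDesc xs)

cstar : ∀ {n k} {G : Graph n} → EdgeColouring G k → Fin n → List ℕ
cstar c v = sortDesc (cbar c v)

ColourBlindDistinguishing : ∀ {n k} {G : Graph n} → EdgeColouring G k → Set
ColourBlindDistinguishing {n} {G = G} c =
  ∀ (u v : Fin n) → Adj G u v → cstar c u ≢ cstar c v

-- dal(G) ≤ m  (dal is the least k admitting such a colouring; ∞ if none)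
DalAtMost : ∀ {n} → Graph n → ℕ → Set
DalAtMost G m = ∃[ k ] (k ≤ m × Σ (EdgeColouring G k) ColourBlindDistinguishing)

module Submission where

-- Root the tree and colour each edge between depths d ∸ 1 and d by ⌊d/2⌋ mod 2.  In a tree
-- adjacent vertices have depths differing by exactly one and every non-root vertex has a
-- unique neighbour closer to the root, so a vertex of even depth sees a single colour, while
-- a vertex of odd depth sees the colour of its parent edge and, if it has a child, the other
-- colour too.  Every edge joins an even and an odd depth, so its endpoints are distinguished
-- unless the odd one is a leaf whose parent has no other neighbour: then the tree is one edge.

open import Defs hiding (sym)
open import Data.Nat using (ℕ; zero; suc; _+_; _≤_; _≤ᵇ_; _<_; _⊔_; z≤n; s≤s)
open import Data.Nat.Properties
  using (1+n≰n; n≤1+n; n<1+n; ≤-refl; ≤-trans; ≤-reflexive; ≤-antisym; ≮⇒≥; <-cmp;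
         m≤m+n; m≤n+m; m≤n⇒m≤1+n; m<1+n⇒m<n∨m≡n; +-monoʳ-≤; +-comm; +-identityʳ;
         suc-injective; ⊔-comm; m≤n⇒m⊔n≡n; m≥n⇒m⊔n≡m)
open import Data.Bool using (true; false; if_then_else_)
import Data.Bool.Properties as Bool
import Data.Nat.Properties as ℕ
open import Data.Fin using (Fin; zero; suc)
open import Data.Fin.Properties using (_≟_; any?; pigeonhole)
import Data.Fin.Properties as Fin
open import Data.List using (List; []; _∷_; _∷ʳ_; [_]; length; tabulate)
open import Data.List.Properties using (∷-injectiveˡ; map-tabulate; length-++-≤ʳ)
open import Data.Nat.ListAction using (sum)
open import Data.List.Relation.Unary.All as All using (All; []; _∷_)
import Data.List.Relation.Unary.All.Properties as All
open import Data.List.Relation.Unary.AllPairs using ([]; _∷_)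
import Data.List.Relation.Unary.AllPairs.Properties as AllPairs
open import Data.List.Relation.Unary.Linked using (Linked; []; [-]; _∷_)
open import Data.List.Relation.Unary.Unique.Propositional using (Unique)
open import Data.Product using (∃-syntax; _×_; _,_; proj₁; proj₂)
import Data.Sum as Sum
open import Data.Sum using (_⊎_; inj₁; inj₂; swap)
open import Data.Empty using (⊥-elim)
open import Function using (_∘_)
open import Relation.Binary.Construct.Closure.ReflexiveTransitive using (Star; ε; _◅_)
open import Relation.Binary.Definitions using (tri<; tri≈; tri>)
open import Relation.Binary.PropositionalEquality
  using (_≡_; _≢_; refl; sym; trans; cong; cong₂; subst; subst₂; ≢-sym; module ≡-Reasoning)
open import Relation.Nullary using (¬_; Dec; yes; no; does)
open import Relation.Nullary.Decidable using (_×-dec_)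
open import Relation.Unary using (Decidable)

sum-tabulate-≥ : ∀ {n} (g : Fin n → ℕ) x → g x ≤ sum (tabulate g)
sum-tabulate-≥ g zero    = m≤m+n _ _
sum-tabulate-≥ g (suc x) = ≤-trans (sum-tabulate-≥ (g ∘ suc) x) (m≤n+m _ (g zero))

sum-tabulate-≥₂ : ∀ {n} (g : Fin n → ℕ) {x y} → x ≢ y → g x + g y ≤ sum (tabulate g)
sum-tabulate-≥₂ g {zero}  {zero}  x≢y = ⊥-elim (x≢y refl)
sum-tabulate-≥₂ g {zero}  {suc y} _   = +-monoʳ-≤ (g zero) (sum-tabulate-≥ (g ∘ suc) y)
sum-tabulate-≥₂ g {suc x} {zero}  _   =
  ≤-trans (≤-reflexive (+-comm (g (suc x)) (g zero))) (+-monoʳ-≤ (g zero) (sum-tabulate-≥ (g ∘ suc) x))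
sum-tabulate-≥₂ g {suc x} {suc y} x≢y =
  ≤-trans (sum-tabulate-≥₂ (g ∘ suc) (x≢y ∘ cong suc)) (m≤n+m _ (g zero))

sum-tabulate-zero : ∀ {n} (g : Fin n → ℕ) → (∀ x → g x ≡ 0) → sum (tabulate g) ≡ 0
sum-tabulate-zero {zero}  g g≡0 = refl
sum-tabulate-zero {suc n} g g≡0 = cong₂ _+_ (g≡0 zero) (sum-tabulate-zero (g ∘ suc) (g≡0 ∘ suc))

sum-tabulate-single : ∀ {n} (g : Fin n → ℕ) a → (∀ x → x ≢ a → g x ≡ 0) → sum (tabulate g) ≡ g a
sum-tabulate-single g zero    g≡0 =
  trans (cong (g zero +_) (sum-tabulate-zero (g ∘ suc) (λ x → g≡0 (suc x) λ ()))) (+-identityʳ _)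
sum-tabulate-single g (suc a) g≡0 =
  cong₂ _+_ (g≡0 zero λ ()) (sum-tabulate-single (g ∘ suc) a (λ x x≢a → g≡0 (suc x) (x≢a ∘ Fin.suc-injective)))

Linked-∷ʳ : ∀ {A : Set} {R : A → A → Set} (xs : List A) {y z} →
            Linked R (xs ∷ʳ y) → R y z → Linked R (xs ∷ʳ y ∷ʳ z)
Linked-∷ʳ []            _           Ryz = Ryz ∷ [-]
Linked-∷ʳ (x ∷ [])      (Rxy ∷ [-]) Ryz = Rxy ∷ Ryz ∷ [-]
Linked-∷ʳ (x ∷ x′ ∷ xs) (Rxx′ ∷ R*) Ryz = Rxx′ ∷ Linked-∷ʳ (x′ ∷ xs) R* Ryz

Unique-between : ∀ {A : Set} {a b : A} {xs} → a ≢ b → All (a ≢_) xs → All (_≢ b) xs →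
                 Unique xs → Unique (a ∷ xs ∷ʳ b)
Unique-between a≢b a∉xs b∉xs xs! =
  All.++⁺ a∉xs (a≢b ∷ []) ∷ AllPairs.++⁺ xs! ([] ∷ []) (All.map (_∷ []) b∉xs)

Fin2-cover : ∀ {a b : Fin 2} → a ≢ b → ∀ i → i ≡ a ⊎ i ≡ b
Fin2-cover {zero}     {zero}     a≢b _          = ⊥-elim (a≢b refl)
Fin2-cover {zero}     {suc zero} _   zero       = inj₁ refl
Fin2-cover {zero}     {suc zero} _   (suc zero) = inj₂ refl
Fin2-cover {suc zero} {zero}     _   zero       = inj₂ refl
Fin2-cover {suc zero} {zero}     _   (suc zero) = inj₁ refl
Fin2-cover {suc zero} {suc zero} a≢b _          = ⊥-elim (a≢b refl)

sortDesc-[0,x] : ∀ x → sortDesc (0 ∷ x ∷ []) ≡ x ∷ 0 ∷ []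
sortDesc-[0,x] zero    = refl
sortDesc-[0,x] (suc x) = refl

sortDesc-positive : ∀ {x y z} → 1 ≤ x → 1 ≤ y → sortDesc (x ∷ y ∷ []) ≢ z ∷ 0 ∷ []
sortDesc-positive {suc x} {suc y} _ _ with suc y ≤ᵇ suc x
... | true  = λ ()
... | false = λ ()

module _ {n} {v w : Fin n} where

  private
    side : ∀ {x} → x ≡ v ⊎ x ≡ w → Fin 2
    side (inj₁ _) = zero
    side (inj₂ _) = suc zero

    side-injective : ∀ {x y} (p : x ≡ v ⊎ x ≡ w) (q : y ≡ v ⊎ y ≡ w) → side p ≡ side q → x ≡ y
    side-injective (inj₁ x≡v) (inj₁ y≡v) _ = trans x≡v (sym y≡v)
    side-injective (inj₂ x≡w) (inj₂ y≡w) _ = trans x≡w (sym y≡w)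

  ¬Fin-covered-by-two : 3 ≤ n → ¬ (∀ x → x ≡ v ⊎ x ≡ w)
  ¬Fin-covered-by-two 3≤n cover with pigeonhole 3≤n (side ∘ cover)
  ... | i , j , i<j , same-side = Fin.<⇒≢ i<j (side-injective (cover i) (cover j) same-side)

Least : (ℕ → Set) → ℕ → Set
Least P m = P m × (∀ {j} → j < m → ¬ P j)

module _ {P : ℕ → Set} (P? : Decidable P) where

  private
    least-below : ∀ k → (∃[ m ] Least P m) ⊎ (∀ {j} → j < k → ¬ P j)
    least-below zero = inj₂ λ ()
    least-below (suc k) with least-below k
    ... | inj₁ found = inj₁ found
    ... | inj₂ none with P? k
    ...   | yes pk = inj₁ (k , pk , none)
    ...   | no ¬pk = inj₂ λ j<1+k → Sum.[ none , (λ { refl → ¬pk }) ] (m<1+n⇒m<n∨m≡n j<1+k)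

  least : ∀ {k} → P k → ∃[ m ] Least P m
  least {k} pk with least-below (suc k)
  ... | inj₁ found = found
  ... | inj₂ none  = ⊥-elim (none (n<1+n k) pk)

Adj-sym : ∀ {n} (G : Graph n) {u v} → Adj G u v → Adj G v u
Adj-sym G {u} {v} uv = trans (Graph.sym G v u) uv

Adj⇒≢ : ∀ {n} (G : Graph n) {u v} → Adj G u v → u ≢ v
Adj⇒≢ G {u} uv refl with trans (sym uv) (irrefl G u)
... | ()

module _ {n} {G : Graph n} {v w : Fin n} where

  isolated-edge-spans : Connected G → (∀ u → Adj G v u → u ≡ w) → (∀ u → Adj G w u → u ≡ v) →
                        ∀ x → x ≡ v ⊎ x ≡ w
  isolated-edge-spans conn only-w only-v x = along (conn x v) (inj₁ refl)
    where
      along : ∀ {x y} → Star (Adj G) x y → y ≡ v ⊎ y ≡ w → x ≡ v ⊎ x ≡ w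
      along ε           y∈ = y∈
      along (xx′ ◅ x′y) y∈ with along x′y y∈
      ... | inj₁ refl = inj₂ (only-w _ (Adj-sym G xx′))
      ... | inj₂ refl = inj₁ (only-v _ (Adj-sym G xx′))

data Within {n} (G : Graph n) (r : Fin n) : ℕ → Fin n → Set where
  start : ∀ {k} → Within G r k r
  step  : ∀ {k u v} → Within G r k u → Adj G u v → Within G r (suc k) v

module _ {n} {G : Graph n} {r : Fin n} where

  within? : ∀ k v → Dec (Within G r k v)
  within? zero v with v ≟ r
  ... | yes refl = yes start
  ... | no v≢r   = no λ { start → v≢r refl }
  within? (suc k) v with v ≟ r | any? (λ u → within? k u ×-dec (adj G u v Bool.≟ true))
  ... | yes refl | _                   = yes start
  ... | no _     | yes (u , ru , uv)   = yes (step ru uv)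
  ... | no v≢r   | no no-predecessor   =
    no λ { start → v≢r refl ; (step ru uv) → no-predecessor (_ , ru , uv) }

  within-mono : ∀ {j k v} → j ≤ k → Within G r j v → Within G r k v
  within-mono _         start       = start
  within-mono (s≤s j≤k) (step ru uv) = step (within-mono j≤k ru) uv

  within-zero : ∀ {v} → Within G r 0 v → v ≡ r
  within-zero start = refl

  within-suc⁻ : ∀ {k v} → Within G r (suc k) v → v ≡ r ⊎ ∃[ u ] (Within G r k u × Adj G u v)
  within-suc⁻ start        = inj₁ refl
  within-suc⁻ (step ru uv) = inj₂ (_ , ru , uv)

  within-walk : ∀ {k u v} → Within G r k u → Star (Adj G) u v → ∃[ k′ ] Within G r k′ v
  within-walk ru ε           = _ , ru
  within-walk ru (uu′ ◅ u′v) = within-walk (step ru uu′) u′v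

record Layering {n} (G : Graph n) (r : Fin n) : Set where
  field
    depth          : Fin n → ℕ
    depth≡0⇒root   : ∀ {v} → depth v ≡ 0 → v ≡ r
    depth-adj      : ∀ {u v} → Adj G u v → depth v ≤ suc (depth u)
    parent         : ∀ {v k} → depth v ≡ suc k → ∃[ u ] (Adj G u v × depth u ≡ k)

module _ {n} {G : Graph n} (conn : Connected G) (r : Fin n) where

  private
    shortest : ∀ v → ∃[ k ] Least (λ k → Within G r k v) k
    shortest v = least (λ k → within? k v) (proj₂ (within-walk (start {k = 0}) (conn r v)))

    depth : Fin n → ℕ
    depth v = proj₁ (shortest v)

    reached : ∀ v → Within G r (depth v) v
    reached v = proj₁ (proj₂ (shortest v))

    depth-≤ : ∀ {k v} → Within G r k v → depth v ≤ k
    depth-≤ {v = v} rv = ≮⇒≥ λ k<depth → proj₂ (proj₂ (shortest v)) k<depth rv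

    depth-adj : ∀ {u v} → Adj G u v → depth v ≤ suc (depth u)
    depth-adj uv = depth-≤ (step (reached _) uv)

    parent : ∀ {v k} → depth v ≡ suc k → ∃[ u ] (Adj G u v × depth u ≡ k)
    parent {v} {k} dv with within-suc⁻ (subst (λ j → Within G r j v) dv (reached v))
    ... | inj₁ refl          = ⊥-elim (unreached start)
      where unreached : ¬ Within G r k v
            unreached = proj₂ (proj₂ (shortest v)) (≤-reflexive (sym dv))
    ... | inj₂ (u , ru , uv) = u , uv , ≤-antisym (depth-≤ ru) (≮⇒≥ too-shallow)
      where
        too-shallow : ¬ depth u < k
        too-shallow du<k = proj₂ (proj₂ (shortest v)) (≤-reflexive (sym dv))
                             (within-mono du<k (step (reached u) uv))

  layering : Layering G r
  layering = record
    { depth        = depth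
    ; depth≡0⇒root = λ {v} dv → within-zero (subst (λ j → Within G r j v) dv (reached v))
    ; depth-adj    = depth-adj
    ; parent       = parent
    }

module _ {n k} {G : Graph n} (c : EdgeColouring G k) where

  private
    indicator : Fin n → Fin k → Fin n → ℕ
    indicator v i u = if adj G v u then (if does (col c v u ≟ i) then 1 else 0) else 0

    colourCount-sum : ∀ v i → colourCount c v i ≡ sum (tabulate (indicator v i))
    colourCount-sum v i = cong sum (map-tabulate (λ u → u) (indicator v i))

    indicator-≡1 : ∀ {v u i} → Adj G v u → col c v u ≡ i → indicator v i u ≡ 1
    indicator-≡1 {v} {u} {i} vu refl rewrite vu with col c v u ≟ col c v u
    ... | yes _ = refl
    ... | no ≢ = ⊥-elim (≢ refl)

    indicator-≡0 : ∀ {v u i} → (Adj G v u → col c v u ≢ i) → indicator v i u ≡ 0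
    indicator-≡0 {v} {u} {i} ¬i with adj G v u
    ... | false = refl
    ... | true with col c v u ≟ i
    ...   | yes ≡i = ⊥-elim (¬i refl ≡i)
    ...   | no _ = refl

  colourCount-≡0 : ∀ {v i} → (∀ u → Adj G v u → col c v u ≢ i) → colourCount c v i ≡ 0
  colourCount-≡0 {v} {i} ¬i =
    trans (colourCount-sum v i) (sum-tabulate-zero _ (λ u → indicator-≡0 (¬i u)))

  colourCount-≥1 : ∀ {v u i} → Adj G v u → col c v u ≡ i → 1 ≤ colourCount c v i
  colourCount-≥1 {v} {u} {i} vu ≡i =
    subst₂ _≤_ (indicator-≡1 vu ≡i) (sym (colourCount-sum v i)) (sum-tabulate-≥ _ u)

  colourCount-≥2 : ∀ {v u u′ i} → u ≢ u′ → Adj G v u → Adj G v u′ →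
                   col c v u ≡ i → col c v u′ ≡ i → 2 ≤ colourCount c v i
  colourCount-≥2 {v} {i = i} u≢u′ vu vu′ ≡i ≡i′ =
    subst₂ _≤_ (cong₂ _+_ (indicator-≡1 vu ≡i) (indicator-≡1 vu′ ≡i′)) (sym (colourCount-sum v i))
      (sum-tabulate-≥₂ _ u≢u′)

  colourCount-≡1 : ∀ {v u i} → Adj G v u → col c v u ≡ i → (∀ u′ → Adj G v u′ → u′ ≡ u) →
                   colourCount c v i ≡ 1
  colourCount-≡1 {v} {u} {i} vu ≡i only-u =
    trans (colourCount-sum v i)
      (trans (sum-tabulate-single _ u (λ u′ u′≢u → indicator-≡0 (λ vu′ _ → u′≢u (only-u u′ vu′))))
             (indicator-≡1 vu ≡i))

module _ {n} {G : Graph n} (c : EdgeColouring G 2) where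

  cstar-one-colour : ∀ {v i} → (∀ u → Adj G v u → col c v u ≡ i) →
                     cstar c v ≡ colourCount c v i ∷ 0 ∷ []
  cstar-one-colour {v} {zero} only-i =
    cong (λ m → sortDesc (colourCount c v zero ∷ m ∷ []))
         (colourCount-≡0 c (λ u vu ≡1 → Fin.0≢1+n (trans (sym (only-i u vu)) ≡1)))
  cstar-one-colour {v} {suc zero} only-i =
    trans (cong (λ m → sortDesc (m ∷ colourCount c v (suc zero) ∷ []))
                (colourCount-≡0 c (λ u vu ≡0 → Fin.0≢1+n (trans (sym ≡0) (only-i u vu)))))
          (sortDesc-[0,x] _)

  cstar-two-colours : ∀ {v u u′ m} → Adj G v u → Adj G v u′ → col c v u ≢ col c v u′ →
                      cstar c v ≢ m ∷ 0 ∷ []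
  cstar-two-colours {v} vu vu′ differ =
    sortDesc-positive (present zero) (present (suc zero))
    where
      present : ∀ i → 1 ≤ colourCount c v i
      present i with Fin2-cover differ i
      ... | inj₁ refl = colourCount-≥1 c vu refl
      ... | inj₂ refl = colourCount-≥1 c vu′ refl

  leaf-distinguished : 3 ≤ n → Connected G → ∀ {x y i} → Adj G x y → (∀ u → Adj G y u → u ≡ x) →
                       (∀ u → Adj G x u → col c x u ≡ i) → cstar c x ≢ cstar c y
  leaf-distinguished 3≤n conn {x} {y} {i} xy only-x one-colour cx≡cy =
    ¬Fin-covered-by-two 3≤n (isolated-edge-spans {G = G} conn only-y only-x)
    where
      cy : cstar c y ≡ 1 ∷ 0 ∷ []
      cy = trans (cstar-one-colour (λ u yu → cong (col c y) (only-x u yu)))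
                 (cong (_∷ 0 ∷ []) (colourCount-≡1 c (Adj-sym G xy) refl only-x))

      count≡1 : colourCount c x i ≡ 1
      count≡1 = ∷-injectiveˡ (trans (sym (cstar-one-colour one-colour)) (trans cx≡cy cy))

      only-y : ∀ u → Adj G x u → u ≡ y
      only-y u xu with u ≟ y
      ... | yes u≡y = u≡y
      ... | no u≢y  = ⊥-elim (1+n≰n (subst (2 ≤_) count≡1
                        (colourCount-≥2 c u≢y xu xy (one-colour u xu) (one-colour y xy))))

module _ {n} {G : Graph n} {r : Fin n} (L : Layering G r) (acyclic : Acyclic G) where

  open Layering L

  private
    deeper-∉ : ∀ {k a xs} → depth a ≡ suc k → All (λ x → depth x ≤ k) xs → All (a ≢_) xs
    deeper-∉ {k} da = All.map λ { dx refl → 1+n≰n (subst (_≤ k) da dx) }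

  depth≡0-unique : ∀ {a b} → depth a ≡ 0 → depth b ≡ 0 → a ≡ b
  depth≡0-unique da db = trans (depth≡0⇒root da) (sym (depth≡0⇒root db))

  record ShallowPath (k : ℕ) (a b : Fin n) : Set where
    field
      inner   : List (Fin n)
      long    : 2 ≤ length (inner ∷ʳ b)
      linked  : Linked (Adj G) (a ∷ inner ∷ʳ b)
      unique  : Unique (a ∷ inner ∷ʳ b)
      shallow : All (λ x → depth x ≤ k) (a ∷ inner ∷ʳ b)

  -- The path climbs from a and b along parents until they meet.
  shallowPath : ∀ {k a b} → depth a ≡ k → depth b ≡ k → a ≢ b → ShallowPath k a b
  shallowPath {zero}  da db a≢b = ⊥-elim (a≢b (depth≡0-unique da db))
  shallowPath {suc k} {a} {b} da db a≢b with parent da | parent db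
  ... | pa , pa-a , dpa | pb , pb-b , dpb with pa ≟ pb
  ...   | yes refl = record
    { inner   = [ pa ]
    ; long    = s≤s (s≤s z≤n)
    ; linked  = Adj-sym G pa-a ∷ pb-b ∷ [-]
    ; unique  = Unique-between a≢b (deeper-∉ da (≤-reflexive dpa ∷ []))
                  (All.map ≢-sym (deeper-∉ db (≤-reflexive dpa ∷ []))) ([] ∷ [])
    ; shallow = ≤-reflexive da ∷ m≤n⇒m≤1+n (≤-reflexive dpa) ∷ ≤-reflexive db ∷ []
    }
  ...   | no pa≢pb = record
    { inner   = pa ∷ P.inner ∷ʳ pb
    ; long    = s≤s (length-++-≤ʳ [ b ] {P.inner ∷ʳ pb})
    ; linked  = Adj-sym G pa-a ∷ Linked-∷ʳ (pa ∷ P.inner) P.linked pb-b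
    ; unique  = Unique-between a≢b (deeper-∉ da P.shallow)
                  (All.map ≢-sym (deeper-∉ db P.shallow)) P.unique
    ; shallow = ≤-reflexive da ∷ All.++⁺ (All.map m≤n⇒m≤1+n P.shallow) (≤-reflexive db ∷ [])
    }
    where module P = ShallowPath (shallowPath dpa dpb pa≢pb)

  no-level-edge : ∀ {a b} → Adj G a b → depth a ≢ depth b
  no-level-edge {a} {b} ab da≡db =
    acyclic a (inner ∷ʳ b) (long , unique , Linked-∷ʳ (a ∷ inner) linked (Adj-sym G ab))
    where open ShallowPath (shallowPath refl (sym da≡db) (Adj⇒≢ G ab))

  unique-parent : ∀ {a b w} → Adj G a w → Adj G b w →
                  depth w ≡ suc (depth a) → depth w ≡ suc (depth b) → a ≡ b
  unique-parent {a} {b} {w} aw bw dw-a dw-b with a ≟ b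
  ... | yes a≡b = a≡b
  ... | no a≢b  = ⊥-elim (acyclic w (a ∷ inner ∷ʳ b)
      ( s≤s (≤-trans (s≤s z≤n) long)
      , deeper-∉ dw-a shallow ∷ unique
      , Adj-sym G aw ∷ Linked-∷ʳ (a ∷ inner) linked bw ))
    where open ShallowPath (shallowPath refl (suc-injective (trans (sym dw-b) dw-a)) a≢b)

  edge-depth : ∀ {u v} → Adj G u v → depth v ≡ suc (depth u) ⊎ depth u ≡ suc (depth v)
  edge-depth {u} {v} uv with <-cmp (depth u) (depth v)
  ... | tri< du<dv _ _ = inj₁ (≤-antisym (depth-adj uv) du<dv)
  ... | tri≈ _ du≡dv _ = ⊥-elim (no-level-edge uv du≡dv)
  ... | tri> _ _ dv<du = inj₂ (≤-antisym (depth-adj (Adj-sym G uv)) dv<du)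

levelColour : ℕ → Fin 2
levelColour 0                         = zero
levelColour 1                         = zero
levelColour 2                         = suc zero
levelColour 3                         = suc zero
levelColour (suc (suc (suc (suc d)))) = levelColour d

Monochrome : ℕ → Set
Monochrome d = levelColour (suc d) ≡ levelColour d

monochrome-alternates : ∀ d → (Monochrome d × ¬ Monochrome (suc d)) ⊎ (Monochrome (suc d) × ¬ Monochrome d)
monochrome-alternates 0                         = inj₁ (refl , λ ())
monochrome-alternates 1                         = inj₂ (refl , λ ())
monochrome-alternates 2                         = inj₁ (refl , λ ())
monochrome-alternates 3                         = inj₂ (refl , λ ())
monochrome-alternates (suc (suc (suc (suc d)))) = monochrome-alternates d

¬monochrome⇒positive : ∀ {d} → ¬ Monochrome d → ∃[ k ] d ≡ suc k
¬monochrome⇒positive {zero}  ¬m = ⊥-elim (¬m refl)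
¬monochrome⇒positive {suc k} _  = k , refl

module _ {n} {G : Graph n} {r : Fin n} (L : Layering G r) where

  open Layering L

  levelColouring : EdgeColouring G 2
  levelColouring = record
    { col     = λ u v → levelColour (depth u ⊔ depth v)
    ; col-sym = λ u v _ → cong levelColour (⊔-comm (depth u) (depth v))
    }

  colour-child : ∀ {u v} → depth v ≡ suc (depth u) → col levelColouring u v ≡ levelColour (depth v)
  colour-child {u} dv = cong levelColour (m≤n⇒m⊔n≡n (subst (depth u ≤_) (sym dv) (n≤1+n _)))

  colour-parent : ∀ {u v} → depth u ≡ suc (depth v) → col levelColouring u v ≡ levelColour (depth u)
  colour-parent {v = v} du = cong levelColour (m≥n⇒m⊔n≡m (subst (depth v ≤_) (sym du) (n≤1+n _)))

module _ {n} {G : Graph n} {r : Fin n} (L : Layering G r) (acyclic : Acyclic G) where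

  open Layering L

  private
    c : EdgeColouring G 2
    c = levelColouring L

  monochrome-vertex : ∀ {x y} → Monochrome (depth x) → Adj G x y → col c x y ≡ levelColour (depth x)
  monochrome-vertex mx xy with edge-depth L acyclic xy
  ... | inj₁ dy = trans (colour-child L dy) (trans (cong levelColour dy) mx)
  ... | inj₂ dx = colour-parent L dx

  monochrome-endpoint : ∀ {u v} → Adj G u v →
    (Monochrome (depth u) × ¬ Monochrome (depth v)) ⊎ (Monochrome (depth v) × ¬ Monochrome (depth u))
  monochrome-endpoint {u} {v} uv with edge-depth L acyclic uv
  ... | inj₁ dv rewrite dv = monochrome-alternates (depth u)
  ... | inj₂ du rewrite du = swap (monochrome-alternates (depth v))

  childless⇒leaf : ∀ {p y} → Adj G p y → depth y ≡ suc (depth p) →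
                   ¬ (∃[ u ] (Adj G y u × depth u ≡ suc (depth y))) → ∀ u → Adj G y u → u ≡ p
  childless⇒leaf py dy childless u yu with edge-depth L acyclic yu
  ... | inj₁ du = ⊥-elim (childless (u , yu , du))
  ... | inj₂ dy′ = unique-parent L acyclic (Adj-sym G yu) py dy′ dy

  -- A vertex at a non-monochrome level sees both colours unless it is a leaf.
  monochrome-neighbour-distinguished : 3 ≤ n → Connected G → ∀ {x y} →
    Monochrome (depth x) → ¬ Monochrome (depth y) → Adj G x y → cstar c x ≢ cstar c y
  monochrome-neighbour-distinguished 3≤n conn {x} {y} mx ¬my xy with ¬monochrome⇒positive ¬my
  ... | _ , dy with parent dy
  ...   | p , py , refl
    with any? (λ u → (adj G y u Bool.≟ true) ×-dec (depth u ℕ.≟ suc (depth y)))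
  ...     | yes (u , yu , du) = λ cx≡cy →
    cstar-two-colours c (Adj-sym G py) yu differ
      (trans (sym cx≡cy) (cstar-one-colour c (λ _ → monochrome-vertex mx)))
    where
      differ : col c y p ≢ col c y u
      differ e = ¬my (begin
        levelColour (suc (depth y)) ≡⟨ cong levelColour du ⟨
        levelColour (depth u)       ≡⟨ colour-child L du ⟨
        col c y u                   ≡⟨ e ⟨
        col c y p                   ≡⟨ colour-parent L dy ⟩
        levelColour (depth y)       ∎)
        where open ≡-Reasoning
  ...     | no childless =
    leaf-distinguished c 3≤n conn xy only-x (λ _ → monochrome-vertex mx)
    where
      only-p : ∀ u → Adj G y u → u ≡ p
      only-p = childless⇒leaf py dy childless

      only-x : ∀ u → Adj G y u → u ≡ x
      only-x u yu = trans (only-p u yu) (sym (only-p x (Adj-sym G xy)))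

  levelColouring-distinguishing : 3 ≤ n → Connected G → ColourBlindDistinguishing c
  levelColouring-distinguishing 3≤n conn u v uv with monochrome-endpoint uv
  ... | inj₁ (mu , ¬mv) = monochrome-neighbour-distinguished 3≤n conn mu ¬mv uv
  ... | inj₂ (mv , ¬mu) = monochrome-neighbour-distinguished 3≤n conn mv ¬mu (Adj-sym G uv) ∘ sym

mainTheorem7 : ∀ (n : ℕ) (T : Graph n) → 3 ≤ n → IsTree T → DalAtMost T 2
mainTheorem7 (suc n) T 3≤n (conn , acyclic) =
  2 , ≤-refl , levelColouring L , levelColouring-distinguishing L acyclic 3≤n conn
  where
    L : Layering T zero
    L = layering conn zero
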